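{- Let $\mathcal{G}$ be a snake graph and $\mathcal{T}_\mathcal{G}$ its oriented contracted snake graph. A vertex of $\mathcal{T}_\mathcal{G}$ is a source or a sink if and only if it is not obtained by contracting an edge of $\mathcal{G}$.
   Context: A snake graph $\mathcal{G}$ with $d\ge1$ tiles is formed by a sequence of unit squares (tiles, each a 4-cycle with north, south, east, west edges) $G_1,\dots,G_d$ in $\mathbb{Z}^2$ such that for each $i<d$, $G_{i+1}$ is either immediately above $G_i$ (north edge of $G_i$ = south edge of $G_{i+1}$) or immediately to the right (east edge of $G_i$ = west edge of $G_{i+1}$). Oriented contracted snake graph: for odd $i$ let $c_i$ be the north edge of $G_i$ and for even $i$ the south edge of $G_i$. $\mathcal{T}_\mathcal{G}$ is obtained from $\mathcal{G}$ by contracting each edge $c_i$ to a single vertex $\mathbf{c}_i$ (a vertex "obtained by contracting an edge"; all other vertices are vertices of $\mathcal{G}$) and orienting the remaining edges: for odd $i$, with $a,b$ the south-west and south-east corners of $G_i$, arrows $a\to b$, $a\to\mathbf{c}_i$ (west edge), $\mathbf{c}_i\to b$ (east edge); for even $i$, with $a,b$ the north-west and north-east corners, arrows $a\to b$, $a\to\mathbf{c}_i$ (west), $\mathbf{c}_i\to b$ (east). A source (sink) is a vertex with no incoming (outgoing) arrows. -}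

module Defs where

open import Data.Nat using (ℕ; zero; suc; _+_; _<_)
open import Data.Bool using (Bool; true; false)
open import Data.Product using (_×_; _,_; Σ; ∃; proj₁; proj₂)
open import Data.Sum using (_⊎_)
open import Data.List using (List; []; _∷_; length)
open import Data.List.Membership.Propositional using (_∈_)
open import Relation.Nullary using (¬_; yes; no)
open import Relation.Binary.PropositionalEquality using (_≡_)
open import Relation.Binary.Construct.Closure.Equivalence using (EqClosure)

-- Lattice points (a snake graph is placed with its first tile's
-- south-west corner at the origin; everything is translation invariant).
Point : Set
Point = ℕ × ℕ

-- Direction of the next tile: N = immediately above, E = immediately right.
data Dir : Set where
  N E : Dir

-- A snake graph with d ≥ 1 tiles is given by the list of d - 1 steps.
Snake : Set
Snake = List Dir

tiles : Snake → ℕ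
tiles ds = suc (length ds)

step : Dir → Point → Point
step N (x , y) = (x , suc y)
step E (x , y) = (suc x , y)

-- south-west corner of the tile with 0-based index k
-- (0-based index k corresponds to the paper's tile G_{k+1})
sw : Snake → ℕ → Point
sw ds       zero    = (0 , 0)
sw []       (suc k) = (0 , 0)
sw (δ ∷ ds) (suc k) = step δ (sw ds k) -- shifts the later snake by the first step

-- parity of the 0-based index k (k even ⇔ paper index k+1 odd)
evenℕ : ℕ → Bool
evenℕ zero = true
evenℕ (suc zero) = false
evenℕ (suc (suc n)) = evenℕ n

swC seC nwC neC : Snake → ℕ → Point
swC ds k = sw ds k
seC ds k = step E (sw ds k)
nwC ds k = step N (sw ds k)
neC ds k = step E (step N (sw ds k))

IsVertex : Snake → Point → Set
IsVertex ds p = Σ ℕ λ k → k < tiles ds ×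
  (p ≡ swC ds k ⊎ p ≡ seC ds k ⊎ p ≡ nwC ds k ⊎ p ≡ neC ds k)

-- The contracted edge c_{k+1} of tile k (0-based) as a pair of endpoints:
-- paper index i = k+1 odd (k even): north edge; i even (k odd): south edge.
cEdge : Snake → ℕ → Point × Point
cEdge ds k with evenℕ k
... | true  = (nwC ds k , neC ds k)
... | false = (swC ds k , seC ds k)

-- the arrows contributed by tile k, written with endpoints in 𝒢
-- (an endpoint of c_i stands for the contracted vertex 𝐜_i).
-- i odd: a = SW, b = SE, arrows a→b, a→𝐜_i (west), 𝐜_i→b (east)
-- i even: a = NW, b = NE, arrows a→b, a→𝐜_i (west), 𝐜_i→b (east)
tileArrows : Snake → ℕ → List (Point × Point)
tileArrows ds k with evenℕ k
... | true  = (swC ds k , seC ds k) ∷ (swC ds k , nwC ds k) ∷ (neC ds k , seC ds k) ∷ []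
... | false = (nwC ds k , neC ds k) ∷ (nwC ds k , swC ds k) ∷ (seC ds k , neC ds k) ∷ []

ContrStep : Snake → Point → Point → Set
ContrStep ds p q = Σ ℕ λ k → k < tiles ds × cEdge ds k ≡ (p , q)

-- p and q become the same vertex of 𝒯_𝒢 (equivalence closure of contraction)
_∶_≈_ : Snake → Point → Point → Set
ds ∶ p ≈ q = EqClosure (ContrStep ds) p q

IsContracted : Snake → Point → Set
IsContracted ds p = Σ ℕ λ k → k < tiles ds × (ds ∶ p ≈ proj₁ (cEdge ds k))

IsSource : Snake → Point → Set
IsSource ds p = ∀ k → k < tiles ds → ∀ u w → (u , w) ∈ tileArrows ds k → ¬ (ds ∶ w ≈ p)

IsSink : Snake → Point → Set
IsSink ds p = ∀ k → k < tiles ds → ∀ u w → (u , w) ∈ tileArrows ds k → ¬ (ds ∶ u ≈ p)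

-- Colour the lattice points like a checkerboard by the parity of x + y.
-- Every arrow of 𝒯_𝒢 runs from a point of colour true to a point of colour
-- false, so a vertex that is not glued to any other point by a contraction is
-- a source or a sink according to its colour.  A contracted vertex 𝐜_i, on
-- the other hand, is the head of the west arrow and the tail of the east
-- arrow of G_i.
module Submission where

open import Defs
open import Data.Sum using (_⊎_)
open import Relation.Nullary using (¬_)
open import Function.Bundles using (_⇔_)

open import Data.Nat using (ℕ; zero; suc; _+_; _<_; s≤s)
open import Data.Nat.Properties using (+-suc)
open import Data.Bool using (Bool; true; false; not)
open import Data.Bool.Properties using (not-involutive)
open import Data.Product using (∃; _×_; _,_; proj₁; proj₂)
open import Data.Sum using (inj₁; inj₂; [_,_])
open import Data.List using ([]; _∷_)
open import Data.List.Membership.Propositional using (_∈_)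
open import Data.List.Relation.Unary.Any using (here; there)
open import Data.Empty using (⊥; ⊥-elim)
open import Function using (_∘_; mk⇔)
open import Relation.Binary.PropositionalEquality using (_≡_; refl; sym; trans; cong; subst; module ≡-Reasoning)
open import Relation.Binary.Construct.Closure.ReflexiveTransitive using (ε; _◅_)
open import Relation.Binary.Construct.Closure.Symmetric using (SymClosure; fwd; bwd)
open import Relation.Binary.Construct.Closure.Equivalence using (symmetric; transitive)

false≢true : false ≡ true → ⊥
false≢true ()

colour : Point → Bool
colour (x , y) = evenℕ (x + y)

evenℕ-suc : ∀ n → evenℕ (suc n) ≡ not (evenℕ n)
evenℕ-suc zero          = refl
evenℕ-suc (suc zero)    = refl
evenℕ-suc (suc (suc n)) = evenℕ-suc n

colour-step : ∀ δ q → colour (step δ q) ≡ not (colour q)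
colour-step N (x , y) = trans (cong evenℕ (+-suc x y)) (evenℕ-suc (x + y))
colour-step E (x , y) = evenℕ-suc (x + y)

colour-sw : ∀ ds k → k < tiles ds → colour (sw ds k) ≡ evenℕ k
colour-sw ds       zero    _         = refl
colour-sw []       (suc k) (s≤s ())
colour-sw (δ ∷ ds) (suc k) (s≤s k<) = begin
  colour (step δ (sw ds k))  ≡⟨ colour-step δ (sw ds k) ⟩
  not (colour (sw ds k))     ≡⟨ cong not (colour-sw ds k k<) ⟩
  not (evenℕ k)              ≡⟨ sym (evenℕ-suc k) ⟩
  evenℕ (suc k)              ∎
  where open ≡-Reasoning

module _ (ds : Snake) (k : ℕ) {b : Bool} (sw≡b : colour (swC ds k) ≡ b) where

  colour-seC : colour (seC ds k) ≡ not b
  colour-seC = trans (colour-step E (sw ds k)) (cong not sw≡b)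

  colour-nwC : colour (nwC ds k) ≡ not b
  colour-nwC = trans (colour-step N (sw ds k)) (cong not sw≡b)

  colour-neC : colour (neC ds k) ≡ b
  colour-neC = trans (colour-step E (nwC ds k))
                     (trans (cong not colour-nwC) (not-involutive b))

arrow-colours : ∀ {ds k u w} → k < tiles ds → (u , w) ∈ tileArrows ds k →
                colour u ≡ true × colour w ≡ false
arrow-colours {ds} {k} k< arrow with evenℕ k | colour-sw ds k k< | arrow
... | true  | c | here refl                = c , colour-seC ds k c
... | true  | c | there (here refl)        = c , colour-nwC ds k c
... | true  | c | there (there (here refl)) = colour-neC ds k c , colour-seC ds k c
... | false | c | here refl                = colour-nwC ds k c , colour-neC ds k c
... | false | c | there (here refl)        = colour-nwC ds k c , c
... | false | c | there (there (here refl)) = colour-seC ds k c , colour-neC ds k c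

west-arrow : ∀ ds k → ∃ λ a → (a , proj₁ (cEdge ds k)) ∈ tileArrows ds k
west-arrow ds k with evenℕ k
... | true  = swC ds k , there (here refl)
... | false = nwC ds k , there (here refl)

east-arrow : ∀ ds k → ∃ λ b → (proj₂ (cEdge ds k) , b) ∈ tileArrows ds k
east-arrow ds k with evenℕ k
... | true  = seC ds k , there (there (here refl))
... | false = neC ds k , there (there (here refl))

contracted-resp-≈ : ∀ {ds p q} → ds ∶ p ≈ q → IsContracted ds q → IsContracted ds p
contracted-resp-≈ p≈q (k , k< , q≈c) = k , k< , transitive _ p≈q q≈c

contrStep-contracted : ∀ {ds p q} → ContrStep ds p q → IsContracted ds p × IsContracted ds q
contrStep-contracted {ds} {p} (k , k< , c≡pq) =
  p-contracted , contracted-resp-≈ (bwd (k , k< , c≡pq) ◅ ε) p-contracted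
  where
  p-contracted : IsContracted ds p
  p-contracted = k , k< , subst (ds ∶ p ≈_) (sym (cong proj₁ c≡pq)) ε

≈⇒≡⊎contracted : ∀ {ds p q} → ds ∶ p ≈ q → p ≡ q ⊎ IsContracted ds q
≈⇒≡⊎contracted ε = inj₁ refl
≈⇒≡⊎contracted (p~r ◅ r≈q) =
  inj₂ (contracted-resp-≈ (symmetric _ r≈q) (target-contracted p~r))
  where
  target-contracted : ∀ {ds p r} → SymClosure (ContrStep ds) p r → IsContracted ds r
  target-contracted (fwd s) = proj₂ (contrStep-contracted s)
  target-contracted (bwd s) = proj₁ (contrStep-contracted s)

uncontracted-≈-colour : ∀ {ds p q} → ¬ IsContracted ds q → ds ∶ p ≈ q → colour p ≡ colour q
uncontracted-≈-colour ¬c p≈q = [ cong colour , ⊥-elim ∘ ¬c ] (≈⇒≡⊎contracted p≈q)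

contracted⇒¬source : ∀ {ds p} → IsContracted ds p → ¬ IsSource ds p
contracted⇒¬source {ds} (k , k< , p≈c) source =
  source k k< _ _ (proj₂ (west-arrow ds k)) (symmetric _ p≈c)

contracted⇒¬sink : ∀ {ds p} → IsContracted ds p → ¬ IsSink ds p
contracted⇒¬sink {ds} (k , k< , p≈c) sink =
  sink k k< _ _ (proj₂ (east-arrow ds k)) (transitive _ c₂≈c₁ (symmetric _ p≈c))
  where
  c₂≈c₁ : ds ∶ proj₂ (cEdge ds k) ≈ proj₁ (cEdge ds k)
  c₂≈c₁ = bwd (k , k< , refl) ◅ ε

uncontracted⇒source⊎sink : ∀ {ds p} → ¬ IsContracted ds p → IsSource ds p ⊎ IsSink ds p
uncontracted⇒source⊎sink {ds} {p} ¬c with colour p in p-colour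
... | true  = inj₁ λ k k< u w arrow w≈p → false≢true (begin
  false     ≡⟨ sym (proj₂ (arrow-colours k< arrow)) ⟩
  colour w  ≡⟨ uncontracted-≈-colour ¬c w≈p ⟩
  colour p  ≡⟨ p-colour ⟩
  true      ∎)
  where open ≡-Reasoning
... | false = inj₂ λ k k< u w arrow u≈p → false≢true (begin
  false     ≡⟨ sym p-colour ⟩
  colour p  ≡⟨ sym (uncontracted-≈-colour ¬c u≈p) ⟩
  colour u  ≡⟨ proj₁ (arrow-colours k< arrow) ⟩
  true      ∎)
  where open ≡-Reasoning

lemma3p19 : (ds : Snake) (p : Point) → IsVertex ds p →
    (IsSource ds p ⊎ IsSink ds p) ⇔ (¬ IsContracted ds p)
lemma3p19 ds p _ = mk⇔ source⊎sink⇒uncontracted uncontracted⇒source⊎sink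
  where
  source⊎sink⇒uncontracted : IsSource ds p ⊎ IsSink ds p → ¬ IsContracted ds p
  source⊎sink⇒uncontracted (inj₁ source) c = contracted⇒¬source c source
  source⊎sink⇒uncontracted (inj₂ sink)   c = contracted⇒¬sink c sink
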